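{- Let $M$ be a matroid and $S$ a nonempty subset of $E(M)$. Not all flags of $M$ collapse in $M\setminus S$ if and only if $r(M)=r(M\setminus S)$. In that case, the flags of $M\setminus S$ are exactly the sequences $(Y_0-S,Y_1-S,\dots,Y_{r(M)}-S)$ where $(Y_i)$ ranges over the flags of $M$ that do not collapse in $M\setminus S$.
   Context: A flag of a rank-$d$ matroid is a sequence $(Y_0,\dots,Y_d)$ where $Y_i$ is a rank-$i$ flat and $Y_i\subsetneq Y_{i+1}$. A flag $(X_i)$ of $M$ collapses in $M\setminus S$ if $X_i-S=X_{i+1}-S$ for some $i$. -}

module Defs where

open import Data.Nat using (ℕ; _≤_; _<_; _+_)
open import Data.Fin using (Fin; toℕ; inject₁; suc)
open import Data.Fin.Subset using (Subset; _⊆_; _⊂_; _∪_; _∩_; _─_; ∣_∣; ⁅_⁆; _∈_; _∉_; ⊥)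
open import Data.Product using (Σ; _×_; ∃)
open import Data.Vec using (_∷_; here; there)
open import Data.Bool using () renaming (true to inside; false to outside)
open import Relation.Binary.PropositionalEquality using (_≡_)

record Matroid (n : ℕ) : Set where
  field
    E : Subset n
    r : Subset n → ℕ
    r-bound : ∀ X → X ⊆ E → r X ≤ ∣ X ∣
    r-mono  : ∀ X Y → Y ⊆ E → X ⊆ Y → r X ≤ r Y
    r-submod : ∀ X Y → X ⊆ E → Y ⊆ E → r (X ∪ Y) + r (X ∩ Y) ≤ r X + r Y
open Matroid public

rank : ∀ {n} → Matroid n → ℕ
rank M = r M (E M)

─-⊆ : ∀ {n} (p q : Subset n) → (p ─ q) ⊆ p
─-⊆ (s ∷ p) (inside ∷ q) (there x∈) = there (─-⊆ p q x∈)
─-⊆ (s ∷ p) (outside ∷ q) here = here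
─-⊆ (s ∷ p) (outside ∷ q) (there x∈) = there (─-⊆ p q x∈)

_∖_ : ∀ {n} → Matroid n → Subset n → Matroid n
M ∖ S = record
  { E = E M ─ S
  ; r = r M
  ; r-bound = λ X X⊆ → r-bound M X (λ x∈ → sub (X⊆ x∈))
  ; r-mono = λ X Y Y⊆ X⊆Y → r-mono M X Y (λ x∈ → sub (Y⊆ x∈)) X⊆Y
  ; r-submod = λ X Y X⊆ Y⊆ → r-submod M X Y (λ x∈ → sub (X⊆ x∈)) (λ x∈ → sub (Y⊆ x∈))
  }
  where
  sub : ∀ {x} → x ∈ E M ─ S → x ∈ E M
  sub = ─-⊆ (E M) S

IsFlat : ∀ {n} → Matroid n → Subset n → Set
IsFlat M X = X ⊆ E M × (∀ e → e ∈ E M → e ∉ X → r M X < r M (X ∪ ⁅ e ⁆))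

IsFlag : ∀ {n} → Matroid n → (d : ℕ) → (Fin (ℕ.suc d) → Subset n) → Set
IsFlag M d Y =
  (d ≡ rank M)
  × (∀ i → IsFlat M (Y i) × r M (Y i) ≡ toℕ i)
  × (∀ (i : Fin d) → Y (inject₁ i) ⊂ Y (suc i))

Collapses : ∀ {n} (S : Subset n) {d : ℕ} → (Fin (ℕ.suc d) → Subset n) → Set
Collapses S {d} Y = ∃ λ (i : Fin d) → Y (inject₁ i) ─ S ≡ Y (suc i) ─ S

-- By submodularity, adding an element outside a flat F raises the rank of every
-- subset of F.  Hence if Y i − S ⊊ Y (i+1) − S in a flag of M, witnessed by some x, then
-- r (Y i − S) < r (Y (i+1) − S); a flag that does not collapse therefore has
-- r (Y i − S) = i, which forces r(M ∖ S) = r(M) and makes (Y i − S) a flag of M ∖ S.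
-- Conversely, if the ranks agree, the M-closures of the flats of a flag Z of M ∖ S form
-- a flag of M with cl Z i − S = Z i, so it does not collapse; and every matroid has a
-- flag, built greedily by closing up one new element at a time.
module Submission where

open import Level using (Level)
open import Data.Nat using (ℕ; zero; suc; _≤_; _<_; _+_; s≤s; _≤?_; _≟_)
open import Data.Nat.Properties
open import Data.Fin using (Fin; zero; suc; toℕ; inject₁; fromℕ)
open import Data.Fin.Properties using (toℕ<n; toℕ-inject₁; toℕ-fromℕ; any?)
open import Data.Fin.Subset using (Subset; _⊆_; _─_; Nonempty; _∪_; _∩_; ⁅_⁆; _∈_; _∉_; _⊂_; ⊥; ∣_∣)
open import Data.Fin.Subset.Properties
  using (_∈?_; x∈p∪q⁻; p⊆p∪q; q⊆p∪q; x∈p∩q⁺; x∈p∩q⁻; x∈⁅x⁆; x∈⁅y⁆⇒x≡y; ∣⁅x⁆∣≡1;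
         ⊆-refl; ⊆-trans; ⊆-antisym; x∈p∧x∉q⇒x∈p─q; p─q⊆p; ∉⊥; ∣⊥∣≡0; ⊂-irref)
open import Data.Product using (_×_; ∃; _,_; proj₁; proj₂)
open import Data.Sum using (_⊎_; inj₁; inj₂; [_,_]′)
open import Data.Empty using (⊥-elim)
open import Data.Bool using (true; false)
import Data.Bool.Properties as Bool
open import Data.Vec using (_∷_; here; there; tabulate)
open import Data.Vec.Properties using (lookup∘tabulate; lookup⇒[]=; []=⇒lookup; ≡-dec)
open import Data.List using (List; []; _∷_; allFin)
import Data.List.Membership.Propositional as List
open import Data.List.Membership.Propositional.Properties using (∈-allFin)
open import Data.List.Relation.Unary.Any using (here; there)
open import Relation.Nullary using (¬_; Dec; yes; no; does; ¬?)
open import Relation.Nullary.Decidable using (_×-dec_; dec-true; decidable-stable)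
open import Relation.Unary using (Pred; Decidable)
open import Relation.Binary.PropositionalEquality
  using (_≡_; _≢_; refl; sym; trans; cong; subst; subst₂; _≗_)
open import Function using (_∘_)
open import Defs

private
  variable
    m : ℕ
    ℓ : Level

x∈p─q⇒x∉q : ∀ {x : Fin m} (p q : Subset m) → x ∈ p ─ q → x ∉ q
x∈p─q⇒x∉q (_ ∷ p) (true ∷ q) (there x∈) (there x∈q) = x∈p─q⇒x∉q p q x∈ x∈q
x∈p─q⇒x∉q (_ ∷ p) (false ∷ q) (there x∈) (there x∈q) = x∈p─q⇒x∉q p q x∈ x∈q

p⊆q⇒p─s⊆q─s : ∀ {p q : Subset m} (s : Subset m) → p ⊆ q → p ─ s ⊆ q ─ s
p⊆q⇒p─s⊆q─s {p = p} s p⊆q x∈ = x∈p∧x∉q⇒x∈p─q (p⊆q (p─q⊆p p s x∈)) (x∈p─q⇒x∉q p s x∈)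

∪-least : ∀ {p q s : Subset m} → p ⊆ s → q ⊆ s → p ∪ q ⊆ s
∪-least {p = p} {q} p⊆s q⊆s x∈ = [ p⊆s , q⊆s ]′ (x∈p∪q⁻ p q x∈)

⁅x⁆⊆p : ∀ {x : Fin m} {p} → x ∈ p → ⁅ x ⁆ ⊆ p
⁅x⁆⊆p {x = x} {p} x∈p y∈ = subst (_∈ p) (sym (x∈⁅y⁆⇒x≡y x y∈)) x∈p

⊆⊎∃∈∉ : (p q : Subset m) → q ⊆ p ⊎ ∃ λ x → x ∈ q × x ∉ p
⊆⊎∃∈∉ p q with any? (λ x → (x ∈? q) ×-dec ¬? (x ∈? p))
... | yes witness = inj₂ witness
... | no ¬witness = inj₁ q⊆p
  where
  q⊆p : q ⊆ p
  q⊆p {x} x∈q with x ∈? p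
  ... | yes x∈p = x∈p
  ... | no x∉p = ⊥-elim (¬witness (x , x∈q , x∉p))

select : {P : Pred (Fin m) ℓ} → Decidable P → Subset m
select P? = tabulate (does ∘ P?)

∈-select⁺ : {P : Pred (Fin m) ℓ} (P? : Decidable P) → ∀ {x} → P x → x ∈ select P?
∈-select⁺ P? {x} px = lookup⇒[]= x _ (trans (lookup∘tabulate (does ∘ P?) x) (dec-true (P? x) px))

∈-select⁻ : {P : Pred (Fin m) ℓ} (P? : Decidable P) → ∀ {x} → x ∈ select P? → P x
∈-select⁻ P? {x} x∈ with P? x | trans (sym (lookup∘tabulate (does ∘ P?) x)) ([]=⇒lookup x∈)
... | yes px | _ = px
... | no _ | ()

strictlyIncreasing⇒+toℕ≤ : ∀ {d} (f : Fin (suc d) → ℕ) →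
  (∀ j → f (inject₁ j) < f (suc j)) → ∀ i → f zero + toℕ i ≤ f i
strictlyIncreasing⇒+toℕ≤ f _ zero = ≤-reflexive (+-identityʳ (f zero))
strictlyIncreasing⇒+toℕ≤ {suc d} f f< (suc i) = begin
  f zero + suc (toℕ i)      ≡⟨ +-suc (f zero) (toℕ i) ⟩
  suc (f zero) + toℕ i      ≤⟨ +-monoˡ-≤ (toℕ i) (f< zero) ⟩
  f (suc zero) + toℕ i      ≤⟨ strictlyIncreasing⇒+toℕ≤ (f ∘ suc) (f< ∘ suc) i ⟩
  f (suc i)                 ∎
  where open ≤-Reasoning

module MatroidTheory {n} (M : Matroid n) where

  r-mono-⊆ : ∀ {X Y} → X ⊆ Y → Y ⊆ E M → r M X ≤ r M Y
  r-mono-⊆ X⊆Y Y⊆E = r-mono M _ _ Y⊆E X⊆Y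

  r-⊥ : r M ⊥ ≡ 0
  r-⊥ = n≤0⇒n≡0 (≤-trans (r-bound M ⊥ (⊥-elim ∘ ∉⊥)) (≤-reflexive (∣⊥∣≡0 n)))

  r-∪⁅⁆≤suc : ∀ {A e} → A ⊆ E M → e ∈ E M → r M (A ∪ ⁅ e ⁆) ≤ suc (r M A)
  r-∪⁅⁆≤suc {A} {e} A⊆E e∈E = begin
    r M (A ∪ ⁅ e ⁆)                        ≤⟨ m≤m+n _ _ ⟩
    r M (A ∪ ⁅ e ⁆) + r M (A ∩ ⁅ e ⁆)      ≤⟨ r-submod M A ⁅ e ⁆ A⊆E (⁅x⁆⊆p e∈E) ⟩
    r M A + r M ⁅ e ⁆                      ≤⟨ +-monoʳ-≤ (r M A) (r-bound M ⁅ e ⁆ (⁅x⁆⊆p e∈E)) ⟩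
    r M A + ∣ ⁅ e ⁆ ∣                      ≡⟨ cong (r M A +_) (∣⁅x⁆∣≡1 e) ⟩
    r M A + 1                              ≡⟨ +-comm (r M A) 1 ⟩
    suc (r M A)                            ∎
    where open ≤-Reasoning

  Spans : Subset n → Fin n → Set
  Spans X e = e ∈ E M × r M (X ∪ ⁅ e ⁆) ≤ r M X

  spans? : ∀ X → Decidable (Spans X)
  spans? X e = (e ∈? E M) ×-dec (r M (X ∪ ⁅ e ⁆) ≤? r M X)

  -- Submodularity applied to X ∪ ⁅e⁆ and A.
  spans-mono : ∀ {X A e} → X ⊆ A → A ⊆ E M → Spans X e → Spans A e
  spans-mono {X} {A} {e} X⊆A A⊆E (e∈E , r[X∪e]≤rX) = e∈E , +-cancelʳ-≤ (r M X) _ _ (begin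
    r M (A ∪ ⁅ e ⁆) + r M X       ≤⟨ +-mono-≤ (r-mono-⊆ A∪e⊆P∪A P∪A⊆E) (r-mono-⊆ X⊆P∩A P∩A⊆E) ⟩
    r M (P ∪ A) + r M (P ∩ A)     ≤⟨ r-submod M P A P⊆E A⊆E ⟩
    r M P + r M A                 ≤⟨ +-monoˡ-≤ (r M A) r[X∪e]≤rX ⟩
    r M X + r M A                 ≡⟨ +-comm (r M X) (r M A) ⟩
    r M A + r M X                 ∎)
    where
    open ≤-Reasoning
    P = X ∪ ⁅ e ⁆
    P⊆E : P ⊆ E M
    P⊆E = ∪-least (⊆-trans X⊆A A⊆E) (⁅x⁆⊆p e∈E)
    P∪A⊆E : P ∪ A ⊆ E M
    P∪A⊆E = ∪-least P⊆E A⊆E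
    P∩A⊆E : P ∩ A ⊆ E M
    P∩A⊆E x∈ = A⊆E (proj₂ (x∈p∩q⁻ P A x∈))
    A∪e⊆P∪A : A ∪ ⁅ e ⁆ ⊆ P ∪ A
    A∪e⊆P∪A = ∪-least (q⊆p∪q P A) (⊆-trans (q⊆p∪q X ⁅ e ⁆) (p⊆p∪q A))
    X⊆P∩A : X ⊆ P ∩ A
    X⊆P∩A x∈ = x∈p∩q⁺ (p⊆p∪q ⁅ e ⁆ x∈ , X⊆A x∈)

  r<r-∪⁅⁆-antimono : ∀ {X A e} → X ⊆ A → A ⊆ E M → e ∈ E M →
    r M A < r M (A ∪ ⁅ e ⁆) → r M X < r M (X ∪ ⁅ e ⁆)
  r<r-∪⁅⁆-antimono {X} {A} {e} X⊆A A⊆E e∈E rA<r[A∪e] with r M (X ∪ ⁅ e ⁆) ≤? r M X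
  ... | no r[X∪e]≰rX = ≰⇒> r[X∪e]≰rX
  ... | yes r[X∪e]≤rX =
    ⊥-elim (<⇒≱ rA<r[A∪e] (proj₂ (spans-mono X⊆A A⊆E (e∈E , r[X∪e]≤rX))))

  flat-∉⇒r< : ∀ {F X e} → IsFlat M F → X ⊆ F → e ∈ E M → e ∉ F → r M X < r M (X ∪ ⁅ e ⁆)
  flat-∉⇒r< (F⊆E , F-closed) X⊆F e∈E e∉F =
    r<r-∪⁅⁆-antimono X⊆F F⊆E e∈E (F-closed _ e∈E e∉F)

  r<⇒⊂ : ∀ {A B} → A ⊆ B → A ⊆ E M → r M A < r M B → A ⊂ B
  r<⇒⊂ {A} {B} A⊆B A⊆E rA<rB with ⊆⊎∃∈∉ A B
  ... | inj₁ B⊆A = ⊥-elim (<⇒≱ rA<rB (r-mono-⊆ B⊆A A⊆E))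
  ... | inj₂ witness = A⊆B , witness

  cl : Subset n → Subset n
  cl X = select (spans? X)

  cl⊆E : ∀ X → cl X ⊆ E M
  cl⊆E X x∈ = proj₁ (∈-select⁻ (spans? X) x∈)

  ⊆cl : ∀ {X} → X ⊆ E M → X ⊆ cl X
  ⊆cl {X} X⊆E x∈X = ∈-select⁺ (spans? X) (X⊆E x∈X , r-mono-⊆ (∪-least ⊆-refl (⁅x⁆⊆p x∈X)) X⊆E)

  cl-mono : ∀ {X Y} → X ⊆ Y → Y ⊆ E M → cl X ⊆ cl Y
  cl-mono {X} {Y} X⊆Y Y⊆E x∈ =
    ∈-select⁺ (spans? Y) (spans-mono X⊆Y Y⊆E (∈-select⁻ (spans? X) x∈))

  -- Adding the elements of A to X one at a time never raises the rank, by spans-mono.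
  r-∪-spanned : ∀ {X A} → X ⊆ E M → (∀ {e} → e ∈ A → Spans X e) → r M (X ∪ A) ≤ r M X
  r-∪-spanned {X} {A} X⊆E A-spanned =
    ≤-trans (r-mono-⊆ X∪A⊆grow (grow⊆E (allFin n))) (r-grow (allFin n))
    where
    grow : List (Fin n) → Subset n
    grow [] = X
    grow (e ∷ es) with e ∈? A
    ... | yes _ = grow es ∪ ⁅ e ⁆
    ... | no _ = grow es

    grow⊆E : ∀ es → grow es ⊆ E M
    grow⊆E [] = X⊆E
    grow⊆E (e ∷ es) with e ∈? A
    ... | yes e∈A = ∪-least (grow⊆E es) (⁅x⁆⊆p (proj₁ (A-spanned e∈A)))
    ... | no _ = grow⊆E es

    ⊆grow : ∀ es → X ⊆ grow es
    ⊆grow [] = ⊆-refl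
    ⊆grow (e ∷ es) with e ∈? A
    ... | yes _ = ⊆-trans (⊆grow es) (p⊆p∪q ⁅ e ⁆)
    ... | no _ = ⊆grow es

    r-grow : ∀ es → r M (grow es) ≤ r M X
    r-grow [] = ≤-refl
    r-grow (e ∷ es) with e ∈? A
    ... | yes e∈A = ≤-trans (proj₂ (spans-mono (⊆grow es) (grow⊆E es) (A-spanned e∈A))) (r-grow es)
    ... | no _ = r-grow es

    A∩es⊆grow : ∀ es {x} → x ∈ A → x List.∈ es → x ∈ grow es
    A∩es⊆grow (e ∷ es) x∈A x∈es with e ∈? A | x∈es
    ... | yes _ | here refl = q⊆p∪q (grow es) ⁅ e ⁆ (x∈⁅x⁆ e)
    ... | yes _ | there x∈es′ = p⊆p∪q ⁅ e ⁆ (A∩es⊆grow es x∈A x∈es′)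
    ... | no e∉A | here refl = ⊥-elim (e∉A x∈A)
    ... | no _ | there x∈es′ = A∩es⊆grow es x∈A x∈es′

    X∪A⊆grow : X ∪ A ⊆ grow (allFin n)
    X∪A⊆grow = ∪-least (⊆grow (allFin n)) (λ {x} x∈A → A∩es⊆grow (allFin n) x∈A (∈-allFin x))

  r-cl : ∀ {X} → X ⊆ E M → r M (cl X) ≡ r M X
  r-cl {X} X⊆E = ≤-antisym
    (≤-trans (r-mono-⊆ (q⊆p∪q X (cl X)) (∪-least X⊆E (cl⊆E X)))
             (r-∪-spanned X⊆E (∈-select⁻ (spans? X))))
    (r-mono-⊆ (⊆cl X⊆E) (cl⊆E X))

  cl-isFlat : ∀ {X} → X ⊆ E M → IsFlat M (cl X)
  cl-isFlat {X} X⊆E = cl⊆E X , cl-closed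
    where
    cl-closed : ∀ e → e ∈ E M → e ∉ cl X → r M (cl X) < r M (cl X ∪ ⁅ e ⁆)
    cl-closed e e∈E e∉cl with r M (X ∪ ⁅ e ⁆) ≤? r M X
    ... | yes r[X∪e]≤rX = ⊥-elim (e∉cl (∈-select⁺ (spans? X) (e∈E , r[X∪e]≤rX)))
    ... | no r[X∪e]≰rX = begin-strict
      r M (cl X)              ≡⟨ r-cl X⊆E ⟩
      r M X                   <⟨ ≰⇒> r[X∪e]≰rX ⟩
      r M (X ∪ ⁅ e ⁆)         ≤⟨ r-mono-⊆ (∪-least (⊆-trans (⊆cl X⊆E) (p⊆p∪q ⁅ e ⁆))
                                                   (q⊆p∪q (cl X) ⁅ e ⁆))
                                          (∪-least (cl⊆E X) (⁅x⁆⊆p e∈E)) ⟩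
      r M (cl X ∪ ⁅ e ⁆)      ∎
      where open ≤-Reasoning

  extend : Subset n → Subset n
  extend F with ⊆⊎∃∈∉ F (E M)
  ... | inj₁ _ = F
  ... | inj₂ (e , _) = cl (F ∪ ⁅ e ⁆)

  extend-covers : ∀ {F} → IsFlat M F → r M F < rank M →
    IsFlat M (extend F) × r M (extend F) ≡ suc (r M F) × F ⊂ extend F
  extend-covers {F} F-flat@(F⊆E , F-closed) rF<rankM with ⊆⊎∃∈∉ F (E M)
  ... | inj₁ E⊆F = ⊥-elim (<⇒≱ rF<rankM (r-mono-⊆ E⊆F F⊆E))
  ... | inj₂ (e , e∈E , e∉F) =
    cl-isFlat G⊆E , r-clG , r<⇒⊂ (⊆-trans (p⊆p∪q ⁅ e ⁆) (⊆cl G⊆E)) F⊆E (≤-reflexive (sym r-clG))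
    where
    G = F ∪ ⁅ e ⁆
    G⊆E : G ⊆ E M
    G⊆E = ∪-least F⊆E (⁅x⁆⊆p e∈E)
    r-clG : r M (cl G) ≡ suc (r M F)
    r-clG = trans (r-cl G⊆E) (≤-antisym (r-∪⁅⁆≤suc F⊆E e∈E) (F-closed e e∈E e∉F))

  level : ℕ → Subset n
  level zero = cl ⊥
  level (suc k) = extend (level k)

  level-isFlat : ∀ k → k ≤ rank M → IsFlat M (level k) × r M (level k) ≡ k
  level-isFlat zero _ = cl-isFlat (⊥-elim ∘ ∉⊥) , trans (r-cl (⊥-elim ∘ ∉⊥)) r-⊥
  level-isFlat (suc k) k<rankM =
    let (flat , rk) = level-isFlat k (<⇒≤ k<rankM)
        (flat′ , rk′ , _) = extend-covers flat (subst (_< rank M) (sym rk) k<rankM)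
    in flat′ , trans rk′ (cong suc rk)

  level-⊂ : ∀ k → k < rank M → level k ⊂ level (suc k)
  level-⊂ k k<rankM =
    let (flat , rk) = level-isFlat k (<⇒≤ k<rankM)
    in proj₂ (proj₂ (extend-covers flat (subst (_< rank M) (sym rk) k<rankM)))

  flag-exists : ∃ (IsFlag M (rank M))
  flag-exists = level ∘ toℕ , refl , (λ i → level-isFlat (toℕ i) (≤-pred (toℕ<n i))) , level-⊂′
    where
    level-⊂′ : ∀ (i : Fin (rank M)) → level (toℕ (inject₁ i)) ⊂ level (suc (toℕ i))
    level-⊂′ i rewrite toℕ-inject₁ i = level-⊂ (toℕ i) (toℕ<n i)

IsFlag-resp-≗ : ∀ {n d} {N : Matroid n} {Y Z : Fin (suc d) → Subset n} →
  Y ≗ Z → IsFlag N d Y → IsFlag N d Z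
IsFlag-resp-≗ {N = N} Y≗Z (d≡rank , Y-flats , Y-strict) =
  d≡rank ,
  (λ i → subst (λ W → IsFlat N W × r N W ≡ toℕ i) (Y≗Z i) (Y-flats i)) ,
  (λ j → subst₂ _⊂_ (Y≗Z (inject₁ j)) (Y≗Z (suc j)) (Y-strict j))

collapses? : ∀ {n} (S : Subset n) {d} (Y : Fin (suc d) → Subset n) → Dec (Collapses S Y)
collapses? S Y = any? (λ j → ≡-dec Bool._≟_ (Y (inject₁ j) ─ S) (Y (suc j) ─ S))

module Deletion {n} (M : Matroid n) (S : Subset n) where
  open MatroidTheory M

  ─S-isFlat : ∀ {F} → IsFlat M F → IsFlat (M ∖ S) (F ─ S)
  ─S-isFlat {F} F-flat@(F⊆E , _) = p⊆q⇒p─s⊆q─s S F⊆E , λ e e∈E─S e∉F─S →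
    flat-∉⇒r< F-flat (p─q⊆p F S) (p─q⊆p (E M) S e∈E─S)
      (λ e∈F → e∉F─S (x∈p∧x∉q⇒x∈p─q e∈F (x∈p─q⇒x∉q (E M) S e∈E─S)))

  r─S< : ∀ {F G} → IsFlat M F → G ⊆ E M → F ⊆ G → F ─ S ≢ G ─ S → r M (F ─ S) < r M (G ─ S)
  r─S< {F} {G} F-flat G⊆E F⊆G F─S≢G─S with ⊆⊎∃∈∉ (F ─ S) (G ─ S)
  ... | inj₁ G─S⊆F─S = ⊥-elim (F─S≢G─S (⊆-antisym (p⊆q⇒p─s⊆q─s S F⊆G) G─S⊆F─S))
  ... | inj₂ (x , x∈G─S , x∉F─S) = begin-strict
    r M (F ─ S)                 <⟨ flat-∉⇒r< F-flat (p─q⊆p F S) x∈E x∉F ⟩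
    r M ((F ─ S) ∪ ⁅ x ⁆)       ≤⟨ r-mono-⊆ (∪-least (p⊆q⇒p─s⊆q─s S F⊆G) (⁅x⁆⊆p x∈G─S))
                                            (⊆-trans (p─q⊆p G S) G⊆E) ⟩
    r M (G ─ S)                 ∎
    where
    open ≤-Reasoning
    x∈E : x ∈ E M
    x∈E = G⊆E (p─q⊆p G S x∈G─S)
    x∉F : x ∉ F
    x∉F x∈F = x∉F─S (x∈p∧x∉q⇒x∈p─q x∈F (x∈p─q⇒x∉q G S x∈G─S))

  toℕ≤r─S : ∀ {d Y} → IsFlag M d Y → ¬ Collapses S Y → ∀ i → toℕ i ≤ r M (Y i ─ S)
  toℕ≤r─S {Y = Y} (_ , Y-flats , Y-strict) noncollapsing i =
    ≤-trans (m≤n+m (toℕ i) _) (strictlyIncreasing⇒+toℕ≤ (λ k → r M (Y k ─ S)) r─S-increasing i)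
    where
    r─S-increasing : ∀ j → r M (Y (inject₁ j) ─ S) < r M (Y (suc j) ─ S)
    r─S-increasing j = r─S< (proj₁ (Y-flats (inject₁ j))) (proj₁ (proj₁ (Y-flats (suc j))))
                            (proj₁ (Y-strict j)) (λ eq → noncollapsing (j , eq))

  nonCollapsing⇒rank≡ : ∀ {d Y} → IsFlag M d Y → ¬ Collapses S Y → rank M ≡ rank (M ∖ S)
  nonCollapsing⇒rank≡ {d} {Y} Y-flag@(d≡rank , Y-flats , _) noncollapsing =
    ≤-antisym rank≤ (r-mono-⊆ (p─q⊆p (E M) S) ⊆-refl)
    where
    open ≤-Reasoning
    rank≤ : rank M ≤ rank (M ∖ S)
    rank≤ = begin
      rank M                    ≡⟨ sym d≡rank ⟩
      d                         ≡⟨ sym (toℕ-fromℕ d) ⟩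
      toℕ (fromℕ d)             ≤⟨ toℕ≤r─S Y-flag noncollapsing (fromℕ d) ⟩
      r M (Y (fromℕ d) ─ S)     ≤⟨ r-mono-⊆ (p⊆q⇒p─s⊆q─s S (proj₁ (proj₁ (Y-flats (fromℕ d)))))
                                            (p─q⊆p (E M) S) ⟩
      rank (M ∖ S)              ∎

  ─S-isFlag : ∀ {d Y} → IsFlag M d Y → ¬ Collapses S Y → IsFlag (M ∖ S) d (λ i → Y i ─ S)
  ─S-isFlag {Y = Y} Y-flag@(d≡rank , Y-flats , Y-strict) noncollapsing =
    trans d≡rank (nonCollapsing⇒rank≡ Y-flag noncollapsing) , ─S-flats , ─S-strict
    where
    ─S-flats : ∀ i → IsFlat (M ∖ S) (Y i ─ S) × r M (Y i ─ S) ≡ toℕ i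
    ─S-flats i =
      let (Yi-flat@(Yi⊆E , _) , r[Yi]≡i) = Y-flats i
      in ─S-isFlat Yi-flat ,
         ≤-antisym (≤-trans (r-mono-⊆ (p─q⊆p (Y i) S) Yi⊆E) (≤-reflexive r[Yi]≡i))
                   (toℕ≤r─S Y-flag noncollapsing i)
    ─S-strict : ∀ j → Y (inject₁ j) ─ S ⊂ Y (suc j) ─ S
    ─S-strict j = r<⇒⊂ (p⊆q⇒p─s⊆q─s S (proj₁ (Y-strict j)))
      (⊆-trans (p─q⊆p _ S) (proj₁ (proj₁ (Y-flats (inject₁ j)))))
      (subst₂ _<_ (sym (proj₂ (─S-flats (inject₁ j)))) (sym (proj₂ (─S-flats (suc j))))
              (s≤s (≤-reflexive (toℕ-inject₁ j))))

  cl─S≡ : ∀ {Z} → IsFlat (M ∖ S) Z → cl Z ─ S ≡ Z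
  cl─S≡ {Z} (Z⊆E─S , Z-closed) = ⊆-antisym cl─S⊆Z Z⊆cl─S
    where
    Z⊆E : Z ⊆ E M
    Z⊆E = ⊆-trans Z⊆E─S (p─q⊆p (E M) S)
    Z⊆cl─S : Z ⊆ cl Z ─ S
    Z⊆cl─S x∈Z = x∈p∧x∉q⇒x∈p─q (⊆cl Z⊆E x∈Z) (x∈p─q⇒x∉q (E M) S (Z⊆E─S x∈Z))
    cl─S⊆Z : cl Z ─ S ⊆ Z
    cl─S⊆Z {x} x∈cl─S with x ∈? Z
    ... | yes x∈Z = x∈Z
    ... | no x∉Z =
      let (x∈E , r[Z∪x]≤rZ) = ∈-select⁻ (spans? Z) (p─q⊆p (cl Z) S x∈cl─S)
          x∈E─S = x∈p∧x∉q⇒x∈p─q x∈E (x∈p─q⇒x∉q (cl Z) S x∈cl─S)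
      in ⊥-elim (<⇒≱ (Z-closed x x∈E─S x∉Z) r[Z∪x]≤rZ)

  cl-isFlag : ∀ {Z} → IsFlag (M ∖ S) (rank M) Z → IsFlag M (rank M) (cl ∘ Z)
  cl-isFlag {Z} (_ , Z-flats , Z-strict) = refl , cl-flats , cl-strict
    where
    Z⊆E : ∀ i → Z i ⊆ E M
    Z⊆E i = ⊆-trans (proj₁ (proj₁ (Z-flats i))) (p─q⊆p (E M) S)
    cl-flats : ∀ i → IsFlat M (cl (Z i)) × r M (cl (Z i)) ≡ toℕ i
    cl-flats i = cl-isFlat (Z⊆E i) , trans (r-cl (Z⊆E i)) (proj₂ (Z-flats i))
    cl-strict : ∀ j → cl (Z (inject₁ j)) ⊂ cl (Z (suc j))
    cl-strict j = r<⇒⊂ (cl-mono (proj₁ (Z-strict j)) (Z⊆E (suc j))) (cl⊆E _)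
      (subst₂ _<_ (sym (proj₂ (cl-flats (inject₁ j)))) (sym (proj₂ (cl-flats (suc j))))
              (s≤s (≤-reflexive (toℕ-inject₁ j))))

  cl-nonCollapsing : ∀ {d Z} → IsFlag (M ∖ S) d Z → ¬ Collapses S (cl ∘ Z)
  cl-nonCollapsing {Z = Z} (_ , Z-flats , Z-strict) (j , collapse) =
    ⊂-irref Z[j]≡Z[j+1] (Z-strict j)
    where
    Z[j]≡Z[j+1] : Z (inject₁ j) ≡ Z (suc j)
    Z[j]≡Z[j+1] = trans (sym (cl─S≡ (proj₁ (Z-flats (inject₁ j)))))
                        (trans collapse (cl─S≡ (proj₁ (Z-flats (suc j)))))

  ¬allCollapse⇒rank≡ : ¬ (∀ Y → IsFlag M (rank M) Y → Collapses S Y) → rank M ≡ rank (M ∖ S)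
  ¬allCollapse⇒rank≡ ¬allCollapse = decidable-stable (rank M ≟ rank (M ∖ S)) λ rank≢ →
    ¬allCollapse λ Y Y-flag → decidable-stable (collapses? S Y) λ noncollapsing →
      rank≢ (nonCollapsing⇒rank≡ Y-flag noncollapsing)

  rank≡⇒¬allCollapse : rank M ≡ rank (M ∖ S) → ¬ (∀ Y → IsFlag M (rank M) Y → Collapses S Y)
  rank≡⇒¬allCollapse rank≡ allCollapse =
    let (Z , Z-flag) = subst (λ d → ∃ (IsFlag (M ∖ S) d)) (sym rank≡)
                             (MatroidTheory.flag-exists (M ∖ S))
    in cl-nonCollapsing Z-flag (allCollapse (cl ∘ Z) (cl-isFlag Z-flag))

lemma4p2 : ∀ {n} (M : Matroid n) (S : Subset n) → S ⊆ E M → Nonempty S →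
  ((¬ (∀ Y → IsFlag M (rank M) Y → Collapses S Y)) → rank M ≡ rank (M ∖ S))
  × (rank M ≡ rank (M ∖ S) → ¬ (∀ Y → IsFlag M (rank M) Y → Collapses S Y))
  × (rank M ≡ rank (M ∖ S) →
      ∀ (Z : Fin (suc (rank M)) → Subset n) →
        (IsFlag (M ∖ S) (rank M) Z →
          ∃ λ Y → IsFlag M (rank M) Y × ¬ Collapses S Y × (∀ i → Z i ≡ Y i ─ S))
        × ((∃ λ Y → IsFlag M (rank M) Y × ¬ Collapses S Y × (∀ i → Z i ≡ Y i ─ S))
          → IsFlag (M ∖ S) (rank M) Z))
lemma4p2 M S _ _ =
  ¬allCollapse⇒rank≡ , rank≡⇒¬allCollapse , λ _ Z → flag∖S⇒nonCollapsing Z , nonCollapsing⇒flag∖S Z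
  where
  open Deletion M S
  open MatroidTheory M using (cl)

  flag∖S⇒nonCollapsing : ∀ Z → IsFlag (M ∖ S) (rank M) Z →
    ∃ λ Y → IsFlag M (rank M) Y × ¬ Collapses S Y × (∀ i → Z i ≡ Y i ─ S)
  flag∖S⇒nonCollapsing Z Z-flag@(_ , Z-flats , _) =
    cl ∘ Z , cl-isFlag Z-flag , cl-nonCollapsing Z-flag , λ i → sym (cl─S≡ (proj₁ (Z-flats i)))

  nonCollapsing⇒flag∖S : ∀ Z →
    (∃ λ Y → IsFlag M (rank M) Y × ¬ Collapses S Y × (∀ i → Z i ≡ Y i ─ S)) → IsFlag (M ∖ S) (rank M) Z
  nonCollapsing⇒flag∖S Z (Y , Y-flag , noncollapsing , Z≗Y─S) =
    IsFlag-resp-≗ {N = M ∖ S} (sym ∘ Z≗Y─S) (─S-isFlag Y-flag noncollapsing)
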